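{- Let $m,n\ge 4$, let $G=G_{n,m}$ be the $n\times m$ grid graph and let $S$ be a connected dominating set of $G$. Let $d_2$ be the number of bends of $G[S]$ and $d_3,d_4$ the numbers of vertices of degree $3$ and $4$ in $G[S]$. Then \[ d_2+d_3+d_4 \geq \left\lceil \frac{\min\{m,n\}}{3}\right\rceil . \]
   Context: Grid graph $G_{n,m}$: vertex set $\{1,\dots,n\}\times\{1,\dots,m\}$, $(i_1,j_1)\sim(i_2,j_2)$ iff $|i_1-i_2|+|j_1-j_2|=1$. A connected dominating set is a set $S$ of vertices with $G[S]$ connected and every vertex in $S$ or adjacent to $S$. A bend is a vertex of $S$ of degree $2$ in $G[S]$ whose two neighbours in $S$ are one in the same row and one in the same column (i.e. a point where a horizontal and a vertical line segment of $G[S]$ meet at a degree-$2$ vertex). -}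

module Defs where

open import Data.Nat using (ℕ; zero; suc; _+_; _≡ᵇ_; _⊓_; _/_)
open import Data.Fin using (Fin; toℕ)
open import Data.Bool using (Bool; true; false; _∧_; _∨_; if_then_else_; T)
open import Data.Product using (_×_; _,_; ∃)
open import Data.List using (List; cartesianProduct; allFin; filterᵇ; length)
open import Relation.Binary.PropositionalEquality using (_≡_)

-- Vertices of the n × m grid G_{n,m}: (i , j) with i ∈ {0..n-1} (row), j ∈ {0..m-1} (column)
-- (0-indexed version of {1..n} × {1..m}).
Vertex : ℕ → ℕ → Set
Vertex n m = Fin n × Fin m

diff1 : ℕ → ℕ → Bool
diff1 a b = (suc a ≡ᵇ b) ∨ (suc b ≡ᵇ a)

adjH : ∀ {n m} → Vertex n m → Vertex n m → Bool
adjH (i₁ , j₁) (i₂ , j₂) = (toℕ i₁ ≡ᵇ toℕ i₂) ∧ diff1 (toℕ j₁) (toℕ j₂)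

adjV : ∀ {n m} → Vertex n m → Vertex n m → Bool
adjV (i₁ , j₁) (i₂ , j₂) = (toℕ j₁ ≡ᵇ toℕ j₂) ∧ diff1 (toℕ i₁) (toℕ i₂)

adj : ∀ {n m} → Vertex n m → Vertex n m → Bool
adj u v = adjH u v ∨ adjV u v

vertices : ∀ n m → List (Vertex n m)
vertices n m = cartesianProduct (allFin n) (allFin m)

VSet : ℕ → ℕ → Set
VSet n m = Vertex n m → Bool

data Reach {n m} (S : VSet n m) : Vertex n m → Vertex n m → Set where
  here : ∀ {u} → T (S u) → Reach S u u
  step : ∀ {u v w} → Reach S u v → T (S w) → T (adj v w) → Reach S u w

Connected : ∀ {n m} → VSet n m → Set
Connected S = ∀ u v → T (S u) → T (S v) → Reach S u v

Dominating : ∀ {n m} → VSet n m → Set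
Dominating S = ∀ u → T (S u) ⊎' ∃ λ v → T (S v) × T (adj u v)
  where
  open import Data.Sum renaming (_⊎_ to _⊎'_)

ConnectedDominating : ∀ {n m} → VSet n m → Set
ConnectedDominating S = Connected S × Dominating S

deg : ∀ {n m} → VSet n m → Vertex n m → ℕ
deg {n} {m} S v = length (filterᵇ (λ w → S w ∧ adj v w) (vertices n m))

degH : ∀ {n m} → VSet n m → Vertex n m → ℕ
degH {n} {m} S v = length (filterᵇ (λ w → S w ∧ adjH v w) (vertices n m))

degV : ∀ {n m} → VSet n m → Vertex n m → ℕ
degV {n} {m} S v = length (filterᵇ (λ w → S w ∧ adjV v w) (vertices n m))

isBend : ∀ {n m} → VSet n m → Vertex n m → Bool
isBend S v = S v ∧ (deg S v ≡ᵇ 2) ∧ (degH S v ≡ᵇ 1) ∧ (degV S v ≡ᵇ 1)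

hasDeg : ∀ {n m} → VSet n m → ℕ → Vertex n m → Bool
hasDeg S k v = S v ∧ (deg S v ≡ᵇ k)

d₂ : ∀ {n m} → VSet n m → ℕ
d₂ {n} {m} S = length (filterᵇ (isBend S) (vertices n m))

d₃ : ∀ {n m} → VSet n m → ℕ
d₃ {n} {m} S = length (filterᵇ (hasDeg S 3) (vertices n m))

d₄ : ∀ {n m} → VSet n m → ℕ
d₄ {n} {m} S = length (filterᵇ (hasDeg S 4) (vertices n m))

⌈_/3⌉ : ℕ → ℕ
⌈ x /3⌉ = (x + 2) / 3

-- Call a vertex of S a turn if it has S-neighbours both in its row and in its column; since
-- a grid vertex has at most two neighbours in each direction, turns are bends or vertices of
-- degree 3 or 4. Group rows (and columns) into bands {3t − 1, 3t, 3t + 1}. With fewer than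
-- min(m,n)/3 turns, pigeonhole yields a row band t and a column band s free of turns, and the
-- vertex (3t, 3s) is dominated by some u ∈ S lying in both bands. As u is not a turn, it lacks,
-- say, vertical S-neighbours. Then a walk in G[S] from u never leaves its row: the first vertex
-- to acquire a vertical S-neighbour would be a turn in the free band. By connectivity S lies in
-- one row, and a single row cannot dominate both row 0 and row 3.
module Submission where

open import Defs
open import Data.Bool using (Bool; true; false; _∧_; _∨_; T)
open import Data.Bool.Properties using (T-∧; T-∨; T-≡; ∧-distribˡ-∨; ∨-comm)
open import Data.Empty using (⊥; ⊥-elim)
open import Data.Fin using (Fin; toℕ; fromℕ<)
open import Data.Fin.Properties using (toℕ-injective; toℕ-fromℕ<; toℕ≤pred[n]; pigeonhole; ¬∀⟶∃¬)
open import Data.List using (List; []; _∷_; map; filterᵇ; length; lookup)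
open import Data.List.Membership.Propositional using (_∈_; _∉_)
open import Data.List.Membership.Propositional.Properties using (∈-filter⁺; ∈-map⁺; ∈-cartesianProduct⁺; ∈-allFin)
open import Data.List.Properties using (length-map; filter-none)
open import Data.List.Relation.Unary.All as All using ()
open import Data.List.Relation.Unary.AllPairs using (_∷_)
open import Data.List.Relation.Unary.Any using (index)
open import Data.List.Relation.Unary.Any.Properties using (lookup-index)
open import Data.List.Relation.Unary.Unique.Propositional using (Unique)
open import Data.List.Relation.Unary.Unique.Propositional.Properties using (cartesianProduct⁺; tabulate⁺)
open import Data.Nat using (ℕ; zero; suc; pred; _≤_; _<_; _+_; _*_; _⊓_; _/_; _≡ᵇ_; z≤n; s≤s; _≟_; _≤?_; NonZero)
open import Data.Nat.Properties
open import Data.Nat.DivMod using (m*n/n≡m; +-distrib-/-∣ˡ; m<n⇒m/n≡0; /-monoˡ-≤)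
open import Data.Nat.Divisibility using (n∣m*n)
open import Data.List.Membership.DecPropositional _≟_ using (_∈?_)
open import Data.Product using (_×_; _,_; proj₁; proj₂; ∃)
open import Data.Sum using (_⊎_; inj₁; inj₂; swap) renaming (map to ⊎-map)
open import Function using (_∘_; id)
open import Function.Bundles using (Equivalence)
open import Relation.Binary.PropositionalEquality
open import Relation.Nullary using (¬_; yes; no; contradiction)
open import Relation.Nullary.Decidable using (T?)

open Equivalence using (to; from)

countᵇ : {A : Set} → (A → Bool) → List A → ℕ
countᵇ p xs = length (filterᵇ p xs)

module _ {A : Set} where

  countᵇ-mono : ∀ {p q : A → Bool} xs → (∀ x → T (p x) → T (q x)) → countᵇ p xs ≤ countᵇ q xs
  countᵇ-mono [] _ = z≤n
  countᵇ-mono {p} {q} (x ∷ xs) p⇒q with p x | q x | p⇒q x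
  ... | true  | true  | _ = s≤s (countᵇ-mono xs p⇒q)
  ... | true  | false | p⇒q-x = ⊥-elim (p⇒q-x _)
  ... | false | true  | _ = m≤n⇒m≤1+n (countᵇ-mono xs p⇒q)
  ... | false | false | _ = countᵇ-mono xs p⇒q

  countᵇ-cong : ∀ {p q : A → Bool} xs → (∀ x → p x ≡ q x) → countᵇ p xs ≡ countᵇ q xs
  countᵇ-cong xs p≗q = ≤-antisym (countᵇ-mono xs (λ x → subst T (p≗q x)))
                                 (countᵇ-mono xs (λ x → subst T (sym (p≗q x))))

  countᵇ-∨ : ∀ (p q : A → Bool) xs → countᵇ (λ x → p x ∨ q x) xs ≤ countᵇ p xs + countᵇ q xs
  countᵇ-∨ p q [] = z≤n
  countᵇ-∨ p q (x ∷ xs) with p x | q x | countᵇ-∨ p q xs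
  ... | true  | true  | ih = s≤s (≤-trans ih (+-monoʳ-≤ (countᵇ p xs) (n≤1+n _)))
  ... | true  | false | ih = s≤s ih
  ... | false | true  | ih = ≤-trans (s≤s ih) (≤-reflexive (sym (+-suc _ _)))
  ... | false | false | ih = ih

  countᵇ-∨-disjoint : ∀ (p q : A → Bool) xs → (∀ x → T (p x) → T (q x) → ⊥) →
                      countᵇ (λ x → p x ∨ q x) xs ≡ countᵇ p xs + countᵇ q xs
  countᵇ-∨-disjoint p q [] _ = refl
  countᵇ-∨-disjoint p q (x ∷ xs) disj with p x | q x | disj x | countᵇ-∨-disjoint p q xs disj
  ... | true  | true  | disj-x | _  = ⊥-elim (disj-x _ _)
  ... | true  | false | _      | ih = cong suc ih
  ... | false | true  | _      | ih = trans (cong suc ih) (sym (+-suc _ _))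
  ... | false | false | _      | ih = ih

  0<countᵇ : ∀ {p : A → Bool} {x xs} → x ∈ xs → T (p x) → 0 < countᵇ p xs
  0<countᵇ {p} {x} x∈xs px = 0<length (∈-filter⁺ (T? ∘ p) x∈xs px)
    where
    0<length : ∀ {ys} → x ∈ ys → 0 < length ys
    0<length {_ ∷ _} _ = s≤s z≤n

  countᵇ-≤1 : ∀ {p : A → Bool} {xs} → Unique xs → (∀ {x y} → T (p x) → T (p y) → x ≡ y) →
              countᵇ p xs ≤ 1
  countᵇ-≤1 {xs = []} _ _ = z≤n
  countᵇ-≤1 {p} {x ∷ xs} (x∉xs ∷ unique) p-single with p x in px
  ... | false = countᵇ-≤1 unique p-single
  ... | true  = s≤s (≤-reflexive (cong length (filter-none (T? ∘ p) (All.map others-fail x∉xs))))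
    where
    others-fail : ∀ {y} → x ≢ y → ¬ T (p y)
    others-fail x≢y py = x≢y (p-single (from T-≡ px) py)

short-list-misses : ∀ {N} (xs : List ℕ) → length xs < N → ∃ λ (t : Fin N) → toℕ t ∉ xs
short-list-misses {N} xs len<N = ¬∀⟶∃¬ N (λ t → toℕ t ∈ xs) (λ t → toℕ t ∈? xs) all-in⇒⊥
  where
  all-in⇒⊥ : ¬ (∀ t → toℕ t ∈ xs)
  all-in⇒⊥ all-in with pigeonhole len<N (λ t → index (all-in t))
  ... | i , j , i<j , same-index = <-irrefl i≡j i<j
    where
    i≡j : toℕ i ≡ toℕ j
    i≡j = trans (lookup-index (all-in i))
                (trans (cong (lookup xs) same-index) (sym (lookup-index (all-in j))))

[m*n+r]/n≡m : ∀ m {n r} .{{_ : NonZero n}} → r < n → (m * n + r) / n ≡ m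
[m*n+r]/n≡m m {n} {r} r<n = begin
  (m * n + r) / n    ≡⟨ +-distrib-/-∣ˡ r (n∣m*n m) ⟩
  m * n / n + r / n  ≡⟨ cong₂ _+_ (m*n/n≡m m n) (m<n⇒m/n≡0 r<n) ⟩
  m + 0              ≡⟨ +-identityʳ m ⟩
  m                  ∎
  where open ≡-Reasoning

⌈/3⌉-≤ : ∀ {x k} → x ≤ 3 * k → ⌈ x /3⌉ ≤ k
⌈/3⌉-≤ {x} {k} x≤3k = begin
  (x + 2) / 3      ≤⟨ /-monoˡ-≤ 3 (+-monoˡ-≤ 2 (≤-trans x≤3k (≤-reflexive (*-comm 3 k)))) ⟩
  (k * 3 + 2) / 3  ≡⟨ [m*n+r]/n≡m k (s≤s (s≤s (s≤s z≤n))) ⟩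
  k                ∎
  where open ≤-Reasoning

data Within1 : ℕ → ℕ → Set where
  same : ∀ {a} → Within1 a a
  next : ∀ {a} → Within1 a (suc a)
  prev : ∀ {a} → Within1 (suc a) a

≡⇒Within1 : ∀ {a b} → a ≡ b → Within1 a b
≡⇒Within1 refl = same

diff⇒Within1 : ∀ {a b} → suc a ≡ b ⊎ suc b ≡ a → Within1 a b
diff⇒Within1 (inj₁ refl) = next
diff⇒Within1 (inj₂ refl) = prev

¬Within1-0-3 : ∀ {r} → Within1 0 r → Within1 3 r → ⊥
¬Within1-0-3 same ()
¬Within1-0-3 next ()

band : ℕ → ℕ
band r = (r + 1) / 3

toℕ*3< : ∀ {k N} (t : Fin (suc k)) → 3 * k < N → toℕ t * 3 < N
toℕ*3< {k} {N} t 3k<N = begin-strict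
  toℕ t * 3  ≤⟨ *-monoˡ-≤ 3 (toℕ≤pred[n] t) ⟩
  k * 3      ≡⟨ *-comm k 3 ⟩
  3 * k      <⟨ 3k<N ⟩
  N          ∎
  where open ≤-Reasoning

band-Within1 : ∀ {a r} t → Within1 a r → a ≡ t * 3 → band r ≡ t
band-Within1 t same refl = [m*n+r]/n≡m t (s≤s (s≤s z≤n))
band-Within1 t next refl = trans (cong (_/ 3) (sym (+-suc (t * 3) 1))) ([m*n+r]/n≡m t (s≤s (s≤s (s≤s z≤n))))
band-Within1 {r = r} t prev e = trans (cong (_/ 3) (trans (+-comm r 1) e)) (m*n/n≡m t 3)

≡ᵇ-comm : ∀ a b → (a ≡ᵇ b) ≡ (b ≡ᵇ a)
≡ᵇ-comm zero    zero    = refl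
≡ᵇ-comm zero    (suc b) = refl
≡ᵇ-comm (suc a) zero    = refl
≡ᵇ-comm (suc a) (suc b) = ≡ᵇ-comm a b

diff1-comm : ∀ a b → diff1 a b ≡ diff1 b a
diff1-comm a b = ∨-comm (suc a ≡ᵇ b) (suc b ≡ᵇ a)

diff1⇒ : ∀ a b → T (diff1 a b) → suc a ≡ b ⊎ suc b ≡ a
diff1⇒ a b d = ⊎-map (≡ᵇ⇒≡ (suc a) b) (≡ᵇ⇒≡ (suc b) a) (to T-∨ d)

module _ {n m : ℕ} where

  row col : Vertex n m → ℕ
  row v = toℕ (proj₁ v)
  col v = toℕ (proj₂ v)

  vertex-≡ : ∀ {v w : Vertex n m} → row v ≡ row w → col v ≡ col w → v ≡ w
  vertex-≡ r≡ c≡ = cong₂ _,_ (toℕ-injective r≡) (toℕ-injective c≡)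

  ∈-vertices : ∀ (v : Vertex n m) → v ∈ vertices n m
  ∈-vertices (i , j) = ∈-cartesianProduct⁺ (∈-allFin i) (∈-allFin j)

  vertices-unique : Unique (vertices n m)
  vertices-unique = cartesianProduct⁺ (tabulate⁺ id) (tabulate⁺ id)

  adjH⇒ : ∀ v w → T (adjH v w) → row v ≡ row w × (suc (col v) ≡ col w ⊎ suc (col w) ≡ col v)
  adjH⇒ v w a with to T-∧ a
  ... | r≡ , d = ≡ᵇ⇒≡ (row v) (row w) r≡ , diff1⇒ (col v) (col w) d

  adjV⇒ : ∀ v w → T (adjV v w) → col v ≡ col w × (suc (row v) ≡ row w ⊎ suc (row w) ≡ row v)
  adjV⇒ v w a with to T-∧ a
  ... | c≡ , d = ≡ᵇ⇒≡ (col v) (col w) c≡ , diff1⇒ (row v) (row w) d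

  adjH-comm : ∀ v w → adjH v w ≡ adjH w v
  adjH-comm v w = cong₂ _∧_ (≡ᵇ-comm (row v) (row w)) (diff1-comm (col v) (col w))

  adjV-comm : ∀ v w → adjV v w ≡ adjV w v
  adjV-comm v w = cong₂ _∧_ (≡ᵇ-comm (col v) (col w)) (diff1-comm (row v) (row w))

  adjH-adjV-disjoint : ∀ v w → T (adjH v w) → T (adjV v w) → ⊥
  adjH-adjV-disjoint v w h x with proj₁ (adjH⇒ v w h) | proj₂ (adjV⇒ v w x)
  ... | r≡ | inj₁ e = 1+n≢n (trans e (sym r≡))
  ... | r≡ | inj₂ e = 1+n≢n (trans e r≡)

  at : ℕ → ℕ → Vertex n m → Bool
  at a b w = (row w ≡ᵇ a) ∧ (col w ≡ᵇ b)

  at⇒ : ∀ {a b} w → T (at a b w) → row w ≡ a × col w ≡ b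
  at⇒ {a} {b} w h with to T-∧ h
  ... | r≡ , c≡ = ≡ᵇ⇒≡ (row w) a r≡ , ≡ᵇ⇒≡ (col w) b c≡

  ⇒at : ∀ {a b} w → row w ≡ a → col w ≡ b → T (at a b w)
  ⇒at {a} {b} w r≡ c≡ = from T-∧ (≡⇒≡ᵇ (row w) a r≡ , ≡⇒≡ᵇ (col w) b c≡)

  countᵇ-at≤1 : ∀ a b → countᵇ (at a b) (vertices n m) ≤ 1
  countᵇ-at≤1 a b = countᵇ-≤1 vertices-unique single
    where
    single : ∀ {v w} → T (at a b v) → T (at a b w) → v ≡ w
    single {v} {w} atv atw with at⇒ v atv | at⇒ w atw
    ... | rv , cv | rw , cw = vertex-≡ (trans rv (sym rw)) (trans cv (sym cw))

  countᵇ-two-sites≤2 : ∀ {p : Vertex n m → Bool} a b a′ b′ →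
                     (∀ w → T (p w) → T (at a b w ∨ at a′ b′ w)) → countᵇ p (vertices n m) ≤ 2
  countᵇ-two-sites≤2 {p} a b a′ b′ p⇒ = begin
    countᵇ p (vertices n m)                                   ≤⟨ countᵇ-mono (vertices n m) p⇒ ⟩
    countᵇ (λ w → at a b w ∨ at a′ b′ w) (vertices n m)       ≤⟨ countᵇ-∨ (at a b) (at a′ b′) (vertices n m) ⟩
    countᵇ (at a b) (vertices n m) + countᵇ (at a′ b′) (vertices n m)
                                                              ≤⟨ +-mono-≤ (countᵇ-at≤1 a b) (countᵇ-at≤1 a′ b′) ⟩
    2                                                         ∎
    where open ≤-Reasoning

  degH≤2 : ∀ S v → degH S v ≤ 2
  degH≤2 S v = countᵇ-two-sites≤2 (row v) (suc (col v)) (row v) (pred (col v)) sites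
    where
    sites : ∀ w → T (S w ∧ adjH v w) → T (at (row v) (suc (col v)) w ∨ at (row v) (pred (col v)) w)
    sites w h with adjH⇒ v w (proj₂ (to (T-∧ {S w}) h))
    ... | r≡ , inj₁ e = from T-∨ (inj₁ (⇒at w (sym r≡) (sym e)))
    ... | r≡ , inj₂ e = from T-∨ (inj₂ (⇒at w (sym r≡) (cong pred e)))

  degV≤2 : ∀ S v → degV S v ≤ 2
  degV≤2 S v = countᵇ-two-sites≤2 (suc (row v)) (col v) (pred (row v)) (col v) sites
    where
    sites : ∀ w → T (S w ∧ adjV v w) → T (at (suc (row v)) (col v) w ∨ at (pred (row v)) (col v) w)
    sites w h with adjV⇒ v w (proj₂ (to (T-∧ {S w}) h))
    ... | c≡ , inj₁ e = from T-∨ (inj₁ (⇒at w (sym e) (sym c≡)))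
    ... | c≡ , inj₂ e = from T-∨ (inj₂ (⇒at w (cong pred e) (sym c≡)))

  deg≡degH+degV : ∀ S v → deg S v ≡ degH S v + degV S v
  deg≡degH+degV S v = trans
    (countᵇ-cong (vertices n m) (λ w → ∧-distribˡ-∨ (S w) (adjH v w) (adjV v w)))
    (countᵇ-∨-disjoint _ _ (vertices n m)
      (λ w h x → adjH-adjV-disjoint v w (proj₂ (to (T-∧ {S w}) h)) (proj₂ (to (T-∧ {S w}) x))))

  0<degree : ∀ (S : VSet n m) (R : Vertex n m → Vertex n m → Bool) {v w} →
             T (S w) → T (R v w) → 0 < countᵇ (λ w → S w ∧ R v w) (vertices n m)
  0<degree S R {w = w} sw r = 0<countᵇ (∈-vertices w) (from T-∧ (sw , r))

  isBendOrBranch : VSet n m → Vertex n m → Bool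
  isBendOrBranch S v = (isBend S v ∨ hasDeg S 3 v) ∨ hasDeg S 4 v

  bendsOrBranches≤d₂+d₃+d₄ : ∀ S → countᵇ (isBendOrBranch S) (vertices n m) ≤ d₂ S + d₃ S + d₄ S
  bendsOrBranches≤d₂+d₃+d₄ S = ≤-trans
    (countᵇ-∨ (λ v → isBend S v ∨ hasDeg S 3 v) (hasDeg S 4) (vertices n m))
    (+-monoˡ-≤ (d₄ S) (countᵇ-∨ (isBend S) (hasDeg S 3) (vertices n m)))

  turn⇒isBendOrBranch : ∀ S v → T (S v) → 0 < degH S v → 0 < degV S v → T (isBendOrBranch S v)
  turn⇒isBendOrBranch S v sv 0<h 0<x
    rewrite to T-≡ sv | deg≡degH+degV S v = classify (degH S v) (degV S v) 0<h (degH≤2 S v) 0<x (degV≤2 S v)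
    where
    classify : ∀ h x → 0 < h → h ≤ 2 → 0 < x → x ≤ 2 →
               T (((h + x ≡ᵇ 2) ∧ (h ≡ᵇ 1) ∧ (x ≡ᵇ 1) ∨ (h + x ≡ᵇ 3)) ∨ (h + x ≡ᵇ 4))
    classify 1 1 _ _ _ _ = _
    classify 1 2 _ _ _ _ = _
    classify 2 1 _ _ _ _ = _
    classify 2 2 _ _ _ _ = _
    classify (suc (suc (suc _))) _ _ (s≤s (s≤s ())) _ _
    classify _ (suc (suc (suc _))) _ _ _ (s≤s (s≤s ()))

reach-end : ∀ {n m} {S : VSet n m} {u x} → Reach S u x → T (S x)
reach-end (here sx)     = sx
reach-end (step _ sx _) = sx

module Line {n m} (S : VSet n m) (coord : Vertex n m → ℕ)
  (along across : Vertex n m → Vertex n m → Bool)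
  (adj⇒ : ∀ v w → T (adj v w) → T (along v w) ⊎ T (across v w))
  (along-comm : ∀ v w → along v w ≡ along w v)
  (along⇒coord : ∀ v w → T (along v w) → coord v ≡ coord w) where

  degAlong degAcross : Vertex n m → ℕ
  degAlong v  = countᵇ (λ w → S w ∧ along v w) (vertices n m)
  degAcross v = countᵇ (λ w → S w ∧ across v w) (vertices n m)

  TurnFree : ℕ → Set
  TurnFree r = ∀ v → T (S v) → coord v ≡ r → 0 < degAlong v → 0 < degAcross v → ⊥

  walk-stays-on-line : ∀ {r} → TurnFree r → ∀ {u x} → coord u ≡ r → degAcross u ≡ 0 →
                       Reach S u x → coord x ≡ r × degAcross x ≡ 0
  walk-stays-on-line turnFree cu du (here _) = cu , du
  walk-stays-on-line {r} turnFree cu du (step {v = v} {w = w} walk sw a)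
    with walk-stays-on-line turnFree cu du walk | adj⇒ v w a
  ... | _ , dv | inj₂ across-vw = contradiction (subst (0 <_) dv (0<degree S across sw across-vw)) (n≮n 0)
  ... | cv , _ | inj₁ along-vw = cw , dw
    where
    cw : coord w ≡ r
    cw = trans (sym (along⇒coord v w along-vw)) cv
    dw : degAcross w ≡ 0
    dw with degAcross w ≟ 0
    ... | yes d≡0 = d≡0
    ... | no  d≢0 = ⊥-elim (turnFree w sw cw
                      (0<degree S along (reach-end walk) (subst T (along-comm v w) along-vw)) (n≢0⇒n>0 d≢0))

  connected⇒on-line : Connected S → ∀ {r} → TurnFree r → ∀ {u} → T (S u) → coord u ≡ r → degAcross u ≡ 0 →
            ∀ x → T (S x) → coord x ≡ r
  connected⇒on-line conn turnFree su cu du x sx = proj₁ (walk-stays-on-line turnFree cu du (conn _ x su sx))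

module RowLine {n m} (S : VSet n m) =
  Line S row adjH adjV (λ v w → to T-∨) adjH-comm (λ v w → proj₁ ∘ adjH⇒ v w)

module ColLine {n m} (S : VSet n m) =
  Line S col adjV adjH (λ v w → swap ∘ to T-∨) adjV-comm (λ v w → proj₁ ∘ adjV⇒ v w)

module _ {n m} (4≤n : 4 ≤ n) (4≤m : 4 ≤ m) (S : VSet n m) (conn : Connected S) (dom : Dominating S) where

  dominator-nearby : ∀ z → ∃ λ u → T (S u) × Within1 (row z) (row u) × Within1 (col z) (col u)
  dominator-nearby z with dom z
  ... | inj₁ sz = z , sz , same , same
  ... | inj₂ (u , su , a) with to T-∨ a
  ...   | inj₁ h = u , su , ≡⇒Within1 (proj₁ (adjH⇒ z u h)) , diff⇒Within1 (proj₂ (adjH⇒ z u h))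
  ...   | inj₂ x = u , su , diff⇒Within1 (proj₂ (adjV⇒ z u x)) , ≡⇒Within1 (proj₁ (adjV⇒ z u x))

  not-in-one-row : ∀ {r} → ¬ (∀ x → T (S x) → row x ≡ r)
  not-in-one-row {r} in-row = ¬Within1-0-3 (near 0 (≤-trans (s≤s z≤n) 4≤n)) (near 3 4≤n)
    where
    j : Fin m
    j = fromℕ< (≤-trans (s≤s z≤n) 4≤m)
    near : ∀ a (a<n : a < n) → Within1 a r
    near a a<n with dominator-nearby (fromℕ< a<n , j)
    ... | u , su , w , _ = subst₂ Within1 (toℕ-fromℕ< a<n) (in-row u su) w

  not-in-one-col : ∀ {r} → ¬ (∀ x → T (S x) → col x ≡ r)
  not-in-one-col {r} in-col = ¬Within1-0-3 (near 0 (≤-trans (s≤s z≤n) 4≤m)) (near 3 4≤m)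
    where
    i : Fin n
    i = fromℕ< (≤-trans (s≤s z≤n) 4≤n)
    near : ∀ a (a<m : a < m) → Within1 a r
    near a a<m with dominator-nearby (i , fromℕ< a<m)
    ... | u , su , _ , w = subst₂ Within1 (toℕ-fromℕ< a<m) (in-col u su) w

  bendsOrBranches : List (Vertex n m)
  bendsOrBranches = filterᵇ (isBendOrBranch S) (vertices n m)

  occupiedRowBands occupiedColBands : List ℕ
  occupiedRowBands = map (band ∘ row) bendsOrBranches
  occupiedColBands = map (band ∘ col) bendsOrBranches

  turn⇒occupied-bands : ∀ v → T (S v) → 0 < degH S v → 0 < degV S v →
                        band (row v) ∈ occupiedRowBands × band (col v) ∈ occupiedColBands
  turn⇒occupied-bands v sv 0<h 0<x = ∈-map⁺ (band ∘ row) v∈ , ∈-map⁺ (band ∘ col) v∈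
    where
    v∈ : v ∈ bendsOrBranches
    v∈ = ∈-filter⁺ (T? ∘ isBendOrBranch S) (∈-vertices v) (turn⇒isBendOrBranch S v sv 0<h 0<x)

  free-row-band⇒turnFree : ∀ {r} → band r ∉ occupiedRowBands → RowLine.TurnFree S r
  free-row-band⇒turnFree free v sv r≡ 0<h 0<x =
    free (subst (_∈ occupiedRowBands) (cong band r≡) (proj₁ (turn⇒occupied-bands v sv 0<h 0<x)))

  free-col-band⇒turnFree : ∀ {r} → band r ∉ occupiedColBands → ColLine.TurnFree S r
  free-col-band⇒turnFree free v sv c≡ 0<x 0<h =
    free (subst (_∈ occupiedColBands) (cong band c≡) (proj₂ (turn⇒occupied-bands v sv 0<h 0<x)))

  free-bands-contain-no-vertex-of-S : ∀ u → T (S u) →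
    band (row u) ∉ occupiedRowBands → band (col u) ∉ occupiedColBands → ⊥
  free-bands-contain-no-vertex-of-S u su row-free col-free with degV S u ≟ 0 | degH S u ≟ 0
  ... | yes dV≡0 | _ =
    not-in-one-row (RowLine.connected⇒on-line S conn (free-row-band⇒turnFree row-free) su refl dV≡0)
  ... | no _ | yes dH≡0 =
    not-in-one-col (ColLine.connected⇒on-line S conn (free-col-band⇒turnFree col-free) su refl dH≡0)
  ... | no dV≢0 | no dH≢0 =
    row-free (proj₁ (turn⇒occupied-bands u su (n≢0⇒n>0 dH≢0) (n≢0⇒n>0 dV≢0)))

  free-band : (c : Vertex n m → ℕ) →
              ∃ λ (t : Fin (suc (length bendsOrBranches))) → toℕ t ∉ map (band ∘ c) bendsOrBranches
  free-band c = short-list-misses (map (band ∘ c) bendsOrBranches)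
                                  (s≤s (≤-reflexive (length-map (band ∘ c) bendsOrBranches)))

  sparse-bendsOrBranches⇒⊥ : 3 * length bendsOrBranches < n → 3 * length bendsOrBranches < m → ⊥
  sparse-bendsOrBranches⇒⊥ 3k<n 3k<m with free-band row | free-band col
  ... | t , t-free | s , s-free with dominator-nearby (fromℕ< (toℕ*3< t 3k<n) , fromℕ< (toℕ*3< s 3k<m))
  ... | u , su , near-row , near-col = free-bands-contain-no-vertex-of-S u su
        (subst (_∉ occupiedRowBands) (sym (band-Within1 (toℕ t) near-row (toℕ-fromℕ< _))) t-free)
        (subst (_∉ occupiedColBands) (sym (band-Within1 (toℕ s) near-col (toℕ-fromℕ< _))) s-free)

  min≤3*#bendsOrBranches : m ⊓ n ≤ 3 * length bendsOrBranches
  min≤3*#bendsOrBranches with m ⊓ n ≤? 3 * length bendsOrBranches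
  ... | yes ≤3k = ≤3k
  ... | no  ≰3k = ⊥-elim (sparse-bendsOrBranches⇒⊥ (≤-trans (≰⇒> ≰3k) (m⊓n≤n m n))
                                                 (≤-trans (≰⇒> ≰3k) (m⊓n≤m m n)))

lemma7 : (n m : ℕ) → 4 ≤ n → 4 ≤ m → (S : VSet n m) → ConnectedDominating S →
    ⌈ m ⊓ n /3⌉ ≤ d₂ S + d₃ S + d₄ S
lemma7 n m 4≤n 4≤m S (conn , dom) = begin
  ⌈ m ⊓ n /3⌉                              ≤⟨ ⌈/3⌉-≤ (min≤3*#bendsOrBranches 4≤n 4≤m S conn dom) ⟩
  countᵇ (isBendOrBranch S) (vertices n m)  ≤⟨ bendsOrBranches≤d₂+d₃+d₄ S ⟩
  d₂ S + d₃ S + d₄ S                        ∎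
  where open ≤-Reasoning
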